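{- Let $N\ge1$ be an integer and $\mathbf t=(k_0,\ell_0,\ldots,k_{N-1},\ell_{N-1})\in\overline{\mathbb N}_+^{2N}$. Then, as formal power series in $\alpha,\beta$, \[ \gamma_{\mathbf t}(\alpha,\beta)=\sum_{0\le n\le N}(-1)^n\,\mathfrak g_{N,n}(\alpha,\beta)\,\mathfrak C_{N,n}(\alpha,\beta), \] where \[ \mathfrak g_{N,n}(\alpha,\beta)=(\alpha\beta)^{N-n}\frac{(1-\alpha-\beta)^n}{\bigl((1-\alpha)(1-\beta)\bigr)^N},\qquad \mathfrak C_{N,n}(\alpha,\beta)=\sum_{\substack{\boldsymbol\tau\in\{0,1\}^{2N}\\ |\boldsymbol\tau|_{10}=n}}(-1)^{|\boldsymbol\tau|_1}\alpha^{\boldsymbol\tau\cdot\mathbf t_{\mathsf e}}\beta^{\boldsymbol\tau\cdot\mathbf t_{\mathsf o}}. \]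
   Context: Let $\overline{\mathbb N}_+=\{1,2,3,\ldots\}\cup\{\infty\}$. Let $\alpha,\beta$ be formal variables, $A_0=\begin{pmatrix}1&0\\ \alpha&\beta\end{pmatrix}$, $A_1=\begin{pmatrix}\alpha&\beta\\0&1\end{pmatrix}$ over $\mathbb C[[\alpha,\beta]]$, with usual powers for finite exponents and $A_0^\infty=\begin{pmatrix}1&0\\ \frac{\alpha}{1-\beta}&0\end{pmatrix}$, $A_1^\infty=\begin{pmatrix}0&\frac{\beta}{1-\alpha}\\0&1\end{pmatrix}$. For $\mathbf t=(k_0,\ell_0,\ldots,k_{N-1},\ell_{N-1})$, $\gamma_{\mathbf t}(\alpha,\beta)$ is the top-left entry of $A_1^{k_0}A_0^{\ell_0}\cdots A_1^{k_{N-1}}A_0^{\ell_{N-1}}$. Put $\mathbf t_{\mathsf e}=(k_0,0,k_1,0,\ldots,k_{N-1},0)$ and $\mathbf t_{\mathsf o}=(0,\ell_0,0,\ell_1,\ldots,0,\ell_{N-1})$. For $\boldsymbol\tau=(\tau_0,\ldots,\tau_{2N-1})\in\{0,1\}^{2N}$: $|\boldsymbol\tau|_1=\#\{j:\tau_j=1\}$, $|\boldsymbol\tau|_{10}=\#\{0\le j<2N-1:(\tau_j,\tau_{j+1})=(1,0)\}$, and $\boldsymbol\tau\cdot\mathbf u=\sum_j\tau_ju_j$ with the conventions $0\cdot\infty=0$, $a+\infty=\infty$, and $\alpha^\infty=\beta^\infty=0$. -}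

module Defs where

open import Data.Nat as ℕ using (ℕ; zero; suc; _∸_; _≤_)
open import Data.Integer as ℤ using (ℤ; 0ℤ; 1ℤ; -_) renaming (_+_ to _+ℤ_; _*_ to _*ℤ_)
open import Data.Bool using (Bool; true; false; if_then_else_)
open import Data.List using (List; []; _∷_; foldr; filter; map; _++_)
open import Data.Vec using (Vec; []; _∷_; toList)
open import Data.Product using (_×_; _,_; proj₁; proj₂)
open import Relation.Binary.PropositionalEquality using (_≡_)
import Data.Nat.Properties as ℕP

-- Formal power series in α, β with integer coefficients:
-- f i j is the coefficient of α^i β^j.  (All series occurring in the
-- statement have integer coefficients; ℤ[[α,β]] ⊂ ℂ[[α,β]].)

PS : Set
PS = ℕ → ℕ → ℤ

infix 4 _≈_
_≈_ : PS → PS → Set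
f ≈ g = ∀ i j → f i j ≡ g i j

0ₚ : PS
0ₚ _ _ = 0ℤ

1ₚ : PS
1ₚ zero zero = 1ℤ
1ₚ _    _    = 0ℤ

αₚ : PS
αₚ (suc zero) zero = 1ℤ
αₚ _ _ = 0ℤ

βₚ : PS
βₚ zero (suc zero) = 1ℤ
βₚ _ _ = 0ℤ

infixl 6 _⊕_ _⊖_
infixl 7 _⊗_

_⊕_ : PS → PS → PS
(f ⊕ g) i j = f i j +ℤ g i j

⊖_ : PS → PS
(⊖ f) i j = - f i j

_⊖_ : PS → PS → PS
f ⊖ g = f ⊕ (⊖ g)

_·ₚ_ : ℤ → PS → PS
(c ·ₚ f) i j = c *ℤ f i j

sumTo : ℕ → (ℕ → ℤ) → ℤ
sumTo zero    h = h zero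
sumTo (suc n) h = sumTo n h +ℤ h (suc n)

_⊗_ : PS → PS → PS
(f ⊗ g) i j = sumTo i λ a → sumTo j λ b → f a b *ℤ g (i ∸ a) (j ∸ b)

_^ₚ_ : PS → ℕ → PS
f ^ₚ zero  = 1ₚ
f ^ₚ suc n = f ⊗ (f ^ₚ n)

-- 1/(1-α) = Σ_i α^i and 1/(1-β) = Σ_j β^j (the inverses in ℤ[[α,β]])
inv1-α : PS
inv1-α _ zero = 1ℤ
inv1-α _ (suc _) = 0ℤ

inv1-β : PS
inv1-β zero _ = 1ℤ
inv1-β (suc _) _ = 0ℤ

Σₚ : List PS → PS
Σₚ = foldr _⊕_ 0ₚ

sgn : ℕ → ℤ
sgn zero    = 1ℤ
sgn (suc n) = - sgn n

data ℕ̄ : Set where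
  fin : ℕ → ℕ̄
  ∞   : ℕ̄

data Pos : ℕ̄ → Set where
  pos-fin : ∀ {k} → 1 ≤ k → Pos (fin k)
  pos-∞   : Pos ∞

infixl 6 _+̄_
_+̄_ : ℕ̄ → ℕ̄ → ℕ̄
fin a +̄ fin b = fin (a ℕ.+ b)
fin _ +̄ ∞     = ∞
∞     +̄ _     = ∞

αpow : ℕ̄ → PS
αpow (fin k) = αₚ ^ₚ k
αpow ∞       = 0ₚ

βpow : ℕ̄ → PS
βpow (fin k) = βₚ ^ₚ k
βpow ∞       = 0ₚ

record Mat : Set where
  constructor mat
  field
    a₁₁ a₁₂ a₂₁ a₂₂ : PS
open Mat public

infixl 7 _⊠_
_⊠_ : Mat → Mat → Mat
mat a b c d ⊠ mat e f g h =
  mat (a ⊗ e ⊕ b ⊗ g) (a ⊗ f ⊕ b ⊗ h) (c ⊗ e ⊕ d ⊗ g) (c ⊗ f ⊕ d ⊗ h)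

I₂ : Mat
I₂ = mat 1ₚ 0ₚ 0ₚ 1ₚ

matPow : Mat → ℕ → Mat
matPow A zero    = I₂
matPow A (suc n) = A ⊠ matPow A n

A₀ : Mat
A₀ = mat 1ₚ 0ₚ αₚ βₚ

A₁ : Mat
A₁ = mat αₚ βₚ 0ₚ 1ₚ

A₀∞ : Mat
A₀∞ = mat 1ₚ 0ₚ (αₚ ⊗ inv1-β) 0ₚ

A₁∞ : Mat
A₁∞ = mat 0ₚ (βₚ ⊗ inv1-α) 0ₚ 1ₚ

A₀^ : ℕ̄ → Mat
A₀^ (fin k) = matPow A₀ k
A₀^ ∞       = A₀∞

A₁^ : ℕ̄ → Mat
A₁^ (fin k) = matPow A₁ k
A₁^ ∞       = A₁∞

-- t = (k₀,ℓ₀,…,k_{N-1},ℓ_{N-1}) is given as the vector of pairs (kᵢ,ℓᵢ)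
-- product A₁^{k₀} A₀^{ℓ₀} ⋯ A₁^{k_{N-1}} A₀^{ℓ_{N-1}}
prodMat : ∀ {N} → Vec (ℕ̄ × ℕ̄) N → Mat
prodMat []             = I₂
prodMat ((k , l) ∷ t) = A₁^ k ⊠ A₀^ l ⊠ prodMat t

γ : ∀ {N} → Vec (ℕ̄ × ℕ̄) N → PS
γ t = a₁₁ (prodMat t)

flat : ∀ {N} → Vec (ℕ̄ × ℕ̄) N → List ℕ̄
flat []             = []
flat ((k , l) ∷ t) = k ∷ l ∷ flat t

tₑ : ∀ {N} → Vec (ℕ̄ × ℕ̄) N → List ℕ̄
tₑ []             = []
tₑ ((k , l) ∷ t) = k ∷ fin 0 ∷ tₑ t

tₒ : ∀ {N} → Vec (ℕ̄ × ℕ̄) N → List ℕ̄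
tₒ []             = []
tₒ ((k , l) ∷ t) = fin 0 ∷ l ∷ tₒ t

bits : ℕ → List (List Bool)
bits zero    = [] ∷ []
bits (suc m) = map (false ∷_) (bits m) ++ map (true ∷_) (bits m)

count1 : List Bool → ℕ
count1 []           = 0
count1 (true ∷ τ)  = suc (count1 τ)
count1 (false ∷ τ) = count1 τ

count10 : List Bool → ℕ
count10 []                   = 0
count10 (true ∷ false ∷ τ)  = suc (count10 (false ∷ τ))
count10 (_ ∷ τ)              = count10 τ

-- τ · u  with 0·∞ = 0 and a + ∞ = ∞
dot : List Bool → List ℕ̄ → ℕ̄
dot (true ∷ τ)  (u ∷ us) = u +̄ dot τ us
dot (false ∷ τ) (u ∷ us) = dot τ us
dot _ _ = fin 0

𝔤 : ℕ → ℕ → PS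
𝔤 N n = ((αₚ ⊗ βₚ) ^ₚ (N ∸ n)) ⊗ ((1ₚ ⊖ αₚ ⊖ βₚ) ^ₚ n) ⊗ ((inv1-α ⊗ inv1-β) ^ₚ N)

ℭ : ∀ {N} → Vec (ℕ̄ × ℕ̄) N → ℕ → PS
ℭ {N} t n =
  Σₚ (map (λ τ → sgn (count1 τ) ·ₚ (αpow (dot τ (tₑ t)) ⊗ βpow (dot τ (tₒ t))))
          (filter (λ τ → count10 τ ℕP.≟ n) (bits (2 ℕ.* N))))

RHS : ∀ {N} → Vec (ℕ̄ × ℕ̄) N → PS
RHS {N} t = Σₚ (map (λ n → sgn n ·ₚ (𝔤 N n ⊗ ℭ t n)) (Data.List.upTo (suc N)))

module Submission where

open import Defs
open import Algebra.Bundles using (CommutativeRing)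
open import Algebra.Structures {A = PS} _≈_ using (IsCommutativeRing)
import Algebra.Properties.CommutativeSemigroup as CommSemigroupProperties
import Algebra.Properties.Ring as RingProperties
import Algebra.Solver.Ring.AlmostCommutativeRing as ACR
open import Data.Bool using (Bool; true; false; if_then_else_)
open import Data.Integer as ℤ using (ℤ; 0ℤ; 1ℤ; -_) renaming (_+_ to _+ℤ_; _*_ to _*ℤ_)
import Data.Integer.Properties as ℤP
open import Data.List using (List; []; _∷_; _++_; map; filter; length; upTo)
import Data.List.Properties as ListP
open import Data.List.Relation.Unary.All as ListAll using ([]; _∷_)
import Data.List.Relation.Unary.All.Properties as ListAllP
open import Data.Maybe using (Maybe; just; nothing)
open import Data.Nat as ℕ using (ℕ; zero; suc; _∸_; _≤_; _<_; z≤n; s≤s; ⌊_/2⌋)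
import Data.Nat.Properties as ℕP
open import Data.Product using (_×_; _,_; proj₁; proj₂)
open import Data.Product.Relation.Binary.Pointwise.NonDependent using (Pointwise; ×-setoid)
open import Data.Vec using (Vec; []; _∷_)
open import Data.Vec.Relation.Unary.All using (All)
open import Function using (_∘_)
open import Level using (0ℓ)
open import Relation.Binary using (Setoid)
open import Relation.Binary.PropositionalEquality
import Relation.Binary.Reasoning.Setoid as SetoidReasoning
open import Relation.Nullary using (Dec; does; yes; no)
open import Relation.Nullary.Decidable using (dec-true; dec-false)

-- With c = α/(1-β) and d = β/(1-α), the matrices upper d X = [[X, d(1-X)], [0, 1]] satisfy
-- upper d X · upper d X′ = upper d (X X′), and A₁ = upper d α, A₁^∞ = upper d 0; likewise
-- lower c Y = [[1, 0], [c(1-Y), Y]] is multiplicative in Y, with A₀ = lower c β and A₀^∞ = lower c 0.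
-- Hence A₁^k A₀^ℓ = upper d α^k · lower c β^ℓ, where α^∞ = β^∞ = 0.  Conjugating by
-- P = [[1, 0], [c, -c]] turns this product into a transfer matrix whose (p, q) entry is
-- Σ_b ω (-X)^b (-Y)^q, the weight ω being w = cd = αβ/((1-α)(1-β)), or
-- w - 1 = -(1-α-β)/((1-α)(1-β)) when (p, b) or (b, q) is (1, 0).  Since P (1, 1)ᵀ = (1, 0)ᵀ,
-- γ_t is the first entry of the product of the transfer matrices applied to (1, 1)ᵀ, and
-- expanding that product gives the sum over τ of the right-hand side, as
-- (-1)^n 𝔤_{N,n} = w^{N-n} (w - 1)^n.

-- Finite sums and the ring of formal power series

sumTo-cong : ∀ n {f g : ℕ → ℤ} → (∀ a → a ≤ n → f a ≡ g a) → sumTo n f ≡ sumTo n g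
sumTo-cong zero    f≗g = f≗g 0 z≤n
sumTo-cong (suc n) f≗g =
  cong₂ _+ℤ_ (sumTo-cong n (λ a a≤n → f≗g a (ℕP.m≤n⇒m≤1+n a≤n))) (f≗g (suc n) ℕP.≤-refl)

sumTo-congʳ : ∀ n {f g : ℕ → ℤ} → (∀ a → f a ≡ g a) → sumTo n f ≡ sumTo n g
sumTo-congʳ n f≗g = sumTo-cong n (λ a _ → f≗g a)

sumTo-+ : ∀ n (f g : ℕ → ℤ) → sumTo n (λ a → f a +ℤ g a) ≡ sumTo n f +ℤ sumTo n g
sumTo-+ zero    f g = refl
sumTo-+ (suc n) f g = begin
  sumTo n (λ a → f a +ℤ g a) +ℤ (f (suc n) +ℤ g (suc n))
    ≡⟨ cong (_+ℤ (f (suc n) +ℤ g (suc n))) (sumTo-+ n f g) ⟩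
  (sumTo n f +ℤ sumTo n g) +ℤ (f (suc n) +ℤ g (suc n))
    ≡⟨ CommSemigroupProperties.interchange ℤP.+-commutativeSemigroup (sumTo n f) (sumTo n g) (f (suc n)) (g (suc n)) ⟩
  (sumTo n f +ℤ f (suc n)) +ℤ (sumTo n g +ℤ g (suc n)) ∎
  where open ≡-Reasoning

*-distribˡ-sumTo : ∀ n c (f : ℕ → ℤ) → c *ℤ sumTo n f ≡ sumTo n (λ a → c *ℤ f a)
*-distribˡ-sumTo zero    c f = refl
*-distribˡ-sumTo (suc n) c f =
  trans (ℤP.*-distribˡ-+ c (sumTo n f) (f (suc n))) (cong (_+ℤ c *ℤ f (suc n)) (*-distribˡ-sumTo n c f))

*-distribʳ-sumTo : ∀ n c (f : ℕ → ℤ) → sumTo n f *ℤ c ≡ sumTo n (λ a → f a *ℤ c)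
*-distribʳ-sumTo zero    c f = refl
*-distribʳ-sumTo (suc n) c f =
  trans (ℤP.*-distribʳ-+ c (sumTo n f) (f (suc n))) (cong (_+ℤ f (suc n) *ℤ c) (*-distribʳ-sumTo n c f))

sumTo-zero : ∀ n (f : ℕ → ℤ) → (∀ a → f a ≡ 0ℤ) → sumTo n f ≡ 0ℤ
sumTo-zero zero    f f≗0 = f≗0 0
sumTo-zero (suc n) f f≗0 = cong₂ _+ℤ_ (sumTo-zero n f f≗0) (f≗0 (suc n))

sumTo-suc : ∀ n (f : ℕ → ℤ) → sumTo (suc n) f ≡ f 0 +ℤ sumTo n (λ a → f (suc a))
sumTo-suc zero    f = refl
sumTo-suc (suc n) f = trans (cong (_+ℤ f (suc (suc n))) (sumTo-suc n f))
  (ℤP.+-assoc (f 0) (sumTo n (λ a → f (suc a))) (f (suc (suc n))))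

sumTo-head : ∀ n (f : ℕ → ℤ) → (∀ a → f (suc a) ≡ 0ℤ) → sumTo n f ≡ f 0
sumTo-head zero    f _    = refl
sumTo-head (suc n) f tail≗0 = begin
  sumTo (suc n) f                    ≡⟨ sumTo-suc n f ⟩
  f 0 +ℤ sumTo n (λ a → f (suc a))  ≡⟨ cong (f 0 +ℤ_) (sumTo-zero n _ tail≗0) ⟩
  f 0 +ℤ 0ℤ                          ≡⟨ ℤP.+-identityʳ (f 0) ⟩
  f 0                                ∎
  where open ≡-Reasoning

sumTo-swap : ∀ n m (F : ℕ → ℕ → ℤ) →
  sumTo n (λ a → sumTo m (F a)) ≡ sumTo m (λ b → sumTo n (λ a → F a b))
sumTo-swap zero    m F = refl
sumTo-swap (suc n) m F = trans (cong (_+ℤ sumTo m (F (suc n))) (sumTo-swap n m F))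
  (sym (sumTo-+ m (λ b → sumTo n (λ a → F a b)) (F (suc n))))

sumTo-reverse : ∀ n (f : ℕ → ℤ) → sumTo n f ≡ sumTo n (λ a → f (n ∸ a))
sumTo-reverse zero    f = refl
sumTo-reverse (suc n) f = begin
  sumTo n f +ℤ f (suc n)                      ≡⟨ cong (_+ℤ f (suc n)) (sumTo-reverse n f) ⟩
  sumTo n (λ a → f (n ∸ a)) +ℤ f (suc n)      ≡⟨ ℤP.+-comm _ (f (suc n)) ⟩
  f (suc n) +ℤ sumTo n (λ a → f (n ∸ a))      ≡⟨ sym (sumTo-suc n (λ a → f (suc n ∸ a))) ⟩
  sumTo (suc n) (λ a → f (suc n ∸ a))         ∎
  where open ≡-Reasoning

sumTo-triangle : ∀ n (G : ℕ → ℕ → ℤ) →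
  sumTo n (λ a → sumTo a (λ c → G c a)) ≡ sumTo n (λ c → sumTo (n ∸ c) (λ d → G c (c ℕ.+ d)))
sumTo-triangle zero    G = refl
sumTo-triangle (suc n) G = begin
  sumTo (suc n) (λ a → sumTo a (λ c → G c a))
    ≡⟨ sumTo-suc n _ ⟩
  G 0 0 +ℤ sumTo n (λ a → sumTo (suc a) (λ c → G c (suc a)))
    ≡⟨ cong (G 0 0 +ℤ_) (sumTo-congʳ n (λ a → sumTo-suc a (λ c → G c (suc a)))) ⟩
  G 0 0 +ℤ sumTo n (λ a → G 0 (suc a) +ℤ sumTo a (λ c → G (suc c) (suc a)))
    ≡⟨ cong (G 0 0 +ℤ_) (sumTo-+ n _ _) ⟩
  G 0 0 +ℤ (sumTo n (λ a → G 0 (suc a)) +ℤ sumTo n (λ a → sumTo a (λ c → G (suc c) (suc a))))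
    ≡⟨ sym (ℤP.+-assoc (G 0 0) _ _) ⟩
  (G 0 0 +ℤ sumTo n (λ a → G 0 (suc a))) +ℤ sumTo n (λ a → sumTo a (λ c → G (suc c) (suc a)))
    ≡⟨ cong₂ _+ℤ_ (sym (sumTo-suc n (G 0))) (sumTo-triangle n (λ c a → G (suc c) (suc a))) ⟩
  sumTo (suc n) (G 0) +ℤ sumTo n (λ c → sumTo (n ∸ c) (λ d → G (suc c) (suc (c ℕ.+ d))))
    ≡⟨ sym (sumTo-suc n _) ⟩
  sumTo (suc n) (λ c → sumTo (suc n ∸ c) (λ d → G c (c ℕ.+ d))) ∎
  where open ≡-Reasoning

≈-refl : ∀ {f} → f ≈ f
≈-refl i j = refl

≈-sym : ∀ {f g} → f ≈ g → g ≈ f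
≈-sym f≈g i j = sym (f≈g i j)

≈-trans : ∀ {f g h} → f ≈ g → g ≈ h → f ≈ h
≈-trans f≈g g≈h i j = trans (f≈g i j) (g≈h i j)

⊕-cong : ∀ {f f′ g g′} → f ≈ f′ → g ≈ g′ → f ⊕ g ≈ f′ ⊕ g′
⊕-cong f≈f′ g≈g′ i j = cong₂ _+ℤ_ (f≈f′ i j) (g≈g′ i j)

⊖-cong : ∀ {f f′} → f ≈ f′ → ⊖ f ≈ ⊖ f′
⊖-cong f≈f′ i j = cong -_ (f≈f′ i j)

⊗-cong : ∀ {f f′ g g′} → f ≈ f′ → g ≈ g′ → f ⊗ g ≈ f′ ⊗ g′
⊗-cong f≈f′ g≈g′ i j =
  sumTo-congʳ i λ a → sumTo-congʳ j λ b → cong₂ _*ℤ_ (f≈f′ a b) (g≈g′ (i ∸ a) (j ∸ b))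

⊗-comm : ∀ f g → f ⊗ g ≈ g ⊗ f
⊗-comm f g i j = begin
  sumTo i (λ a → sumTo j (λ b → f a b *ℤ g (i ∸ a) (j ∸ b)))
    ≡⟨ sumTo-reverse i _ ⟩
  sumTo i (λ a → sumTo j (λ b → f (i ∸ a) b *ℤ g (i ∸ (i ∸ a)) (j ∸ b)))
    ≡⟨ sumTo-congʳ i (λ a → sumTo-reverse j _) ⟩
  sumTo i (λ a → sumTo j (λ b → f (i ∸ a) (j ∸ b) *ℤ g (i ∸ (i ∸ a)) (j ∸ (j ∸ b))))
    ≡⟨ sumTo-cong i (λ a a≤i → sumTo-cong j (λ b b≤j →
         trans (ℤP.*-comm (f (i ∸ a) (j ∸ b)) _)
               (cong₂ (λ x y → g x y *ℤ f (i ∸ a) (j ∸ b)) (ℕP.m∸[m∸n]≡n a≤i) (ℕP.m∸[m∸n]≡n b≤j)))) ⟩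
  sumTo i (λ a → sumTo j (λ b → g a b *ℤ f (i ∸ a) (j ∸ b))) ∎
  where open ≡-Reasoning

⊗-distribˡ-⊕ : ∀ f g h → f ⊗ (g ⊕ h) ≈ f ⊗ g ⊕ f ⊗ h
⊗-distribˡ-⊕ f g h i j = begin
  sumTo i (λ a → sumTo j (λ b → f a b *ℤ (g (i ∸ a) (j ∸ b) +ℤ h (i ∸ a) (j ∸ b))))
    ≡⟨ sumTo-congʳ i (λ a → sumTo-congʳ j (λ b → ℤP.*-distribˡ-+ (f a b) _ _)) ⟩
  sumTo i (λ a → sumTo j (λ b → f a b *ℤ g (i ∸ a) (j ∸ b) +ℤ f a b *ℤ h (i ∸ a) (j ∸ b)))
    ≡⟨ sumTo-congʳ i (λ a → sumTo-+ j _ _) ⟩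
  sumTo i (λ a → sumTo j (λ b → f a b *ℤ g (i ∸ a) (j ∸ b)) +ℤ sumTo j (λ b → f a b *ℤ h (i ∸ a) (j ∸ b)))
    ≡⟨ sumTo-+ i _ _ ⟩
  (f ⊗ g ⊕ f ⊗ h) i j ∎
  where open ≡-Reasoning

⊗-distribʳ-⊕ : ∀ f g h → (g ⊕ h) ⊗ f ≈ g ⊗ f ⊕ h ⊗ f
⊗-distribʳ-⊕ f g h = ≈-trans (⊗-comm (g ⊕ h) f)
  (≈-trans (⊗-distribˡ-⊕ f g h) (⊕-cong (⊗-comm f g) (⊗-comm f h)))

⊗-identityˡ : ∀ f → 1ₚ ⊗ f ≈ f
⊗-identityˡ f i j = begin
  sumTo i (λ a → sumTo j (λ b → 1ₚ a b *ℤ f (i ∸ a) (j ∸ b)))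
    ≡⟨ sumTo-head i _ (λ a → sumTo-zero j _ (λ b → refl)) ⟩
  sumTo j (λ b → 1ₚ 0 b *ℤ f i (j ∸ b))
    ≡⟨ sumTo-head j _ (λ b → refl) ⟩
  1ℤ *ℤ f i j
    ≡⟨ ℤP.*-identityˡ _ ⟩
  f i j ∎
  where open ≡-Reasoning

-- Both sides are Σ f c d · g a e · h (i - c - a) (j - d - e) over c + a ≤ i, d + e ≤ j.
⊗-assoc : ∀ f g h → (f ⊗ g) ⊗ h ≈ f ⊗ (g ⊗ h)
⊗-assoc f g h i j = begin
  sumTo i (λ a → sumTo j (λ b → sumTo a (λ c → sumTo b (λ d → f c d *ℤ g (a ∸ c) (b ∸ d))) *ℤ h (i ∸ a) (j ∸ b)))
    ≡⟨ sumTo-congʳ i (λ a → sumTo-congʳ j (λ b → trans (*-distribʳ-sumTo a _ _)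
         (sumTo-congʳ a (λ c → *-distribʳ-sumTo b _ _)))) ⟩
  sumTo i (λ a → sumTo j (λ b → sumTo a (λ c → sumTo b (λ d → K c d a b))))
    ≡⟨ sumTo-congʳ i (λ a → sumTo-swap j a _) ⟩
  sumTo i (λ a → sumTo a (λ c → sumTo j (λ b → sumTo b (λ d → K c d a b))))
    ≡⟨ sumTo-congʳ i (λ a → sumTo-congʳ a (λ c → sumTo-triangle j (λ d b → K c d a b))) ⟩
  sumTo i (λ a → sumTo a (λ c → sumTo j (λ d → sumTo (j ∸ d) (λ e → K c d a (d ℕ.+ e)))))
    ≡⟨ sumTo-triangle i _ ⟩
  sumTo i (λ c → sumTo (i ∸ c) (λ a → sumTo j (λ d → sumTo (j ∸ d) (λ e → K c d (c ℕ.+ a) (d ℕ.+ e)))))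
    ≡⟨ sumTo-congʳ i (λ c → sumTo-swap (i ∸ c) j _) ⟩
  sumTo i (λ c → sumTo j (λ d → sumTo (i ∸ c) (λ a → sumTo (j ∸ d) (λ e → K c d (c ℕ.+ a) (d ℕ.+ e)))))
    ≡⟨ sumTo-congʳ i (λ c → sumTo-congʳ j (λ d → sumTo-congʳ (i ∸ c) (λ a → sumTo-congʳ (j ∸ d) (λ e →
         reindex c d a e)))) ⟩
  sumTo i (λ c → sumTo j (λ d → sumTo (i ∸ c) (λ a → sumTo (j ∸ d) (λ e → f c d *ℤ (g a e *ℤ h (i ∸ c ∸ a) (j ∸ d ∸ e))))))
    ≡⟨ sym (sumTo-congʳ i (λ c → sumTo-congʳ j (λ d → trans (*-distribˡ-sumTo (i ∸ c) (f c d) _)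
         (sumTo-congʳ (i ∸ c) (λ a → *-distribˡ-sumTo (j ∸ d) (f c d) _))))) ⟩
  (f ⊗ (g ⊗ h)) i j ∎
  where
  open ≡-Reasoning
  K : ℕ → ℕ → ℕ → ℕ → ℤ
  K c d a b = f c d *ℤ g (a ∸ c) (b ∸ d) *ℤ h (i ∸ a) (j ∸ b)
  reindex : ∀ c d a e → K c d (c ℕ.+ a) (d ℕ.+ e) ≡ f c d *ℤ (g a e *ℤ h (i ∸ c ∸ a) (j ∸ d ∸ e))
  reindex c d a e = begin
    f c d *ℤ g (c ℕ.+ a ∸ c) (d ℕ.+ e ∸ d) *ℤ h (i ∸ (c ℕ.+ a)) (j ∸ (d ℕ.+ e))
      ≡⟨ cong₂ (λ x y → f c d *ℤ g x y *ℤ h (i ∸ (c ℕ.+ a)) (j ∸ (d ℕ.+ e))) (ℕP.m+n∸m≡n c a) (ℕP.m+n∸m≡n d e) ⟩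
    f c d *ℤ g a e *ℤ h (i ∸ (c ℕ.+ a)) (j ∸ (d ℕ.+ e))
      ≡⟨ cong₂ (λ x y → f c d *ℤ g a e *ℤ h x y) (sym (ℕP.∸-+-assoc i c a)) (sym (ℕP.∸-+-assoc j d e)) ⟩
    f c d *ℤ g a e *ℤ h (i ∸ c ∸ a) (j ∸ d ∸ e)
      ≡⟨ ℤP.*-assoc (f c d) _ _ ⟩
    f c d *ℤ (g a e *ℤ h (i ∸ c ∸ a) (j ∸ d ∸ e)) ∎

PS-isCommutativeRing : IsCommutativeRing _⊕_ _⊗_ ⊖_ 0ₚ 1ₚ
PS-isCommutativeRing = record
  { isRing = record
    { +-isAbelianGroup = record
      { isGroup = record
        { isMonoid = record
          { isSemigroup = record
            { isMagma = record
              { isEquivalence = record { refl = ≈-refl ; sym = ≈-sym ; trans = ≈-trans }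
              ; ∙-cong = ⊕-cong }
            ; assoc = λ f g h i j → ℤP.+-assoc (f i j) (g i j) (h i j) }
          ; identity = (λ f i j → ℤP.+-identityˡ (f i j)) , (λ f i j → ℤP.+-identityʳ (f i j)) }
        ; inverse = (λ f i j → ℤP.+-inverseˡ (f i j)) , (λ f i j → ℤP.+-inverseʳ (f i j))
        ; ⁻¹-cong = ⊖-cong }
      ; comm = λ f g i j → ℤP.+-comm (f i j) (g i j) }
    ; *-cong = ⊗-cong
    ; *-assoc = ⊗-assoc
    ; *-identity = ⊗-identityˡ , (λ f → ≈-trans (⊗-comm f 1ₚ) (⊗-identityˡ f))
    ; distrib = ⊗-distribˡ-⊕ , ⊗-distribʳ-⊕ }
  ; *-comm = ⊗-comm }

PS-commutativeRing : CommutativeRing 0ℓ 0ℓ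
PS-commutativeRing = record { isCommutativeRing = PS-isCommutativeRing }

open CommutativeRing PS-commutativeRing
  using (+-identityˡ; +-identityʳ; +-assoc; *-identityʳ; *-assoc; zeroˡ; zeroʳ; distribˡ; *-commutativeSemigroup)
open RingProperties (CommutativeRing.ring PS-commutativeRing) using (-‿distribˡ-*)

PS-setoid : Setoid 0ℓ 0ℓ
PS-setoid = CommutativeRing.setoid PS-commutativeRing

module ≈-Reasoning = SetoidReasoning PS-setoid

-- 0 and 1 go to 0ₚ and 1ₚ on the nose, so that the solver's constants match the statements.
ι : ℤ → PS
ι (ℤ.+ 0) = 0ₚ
ι (ℤ.+ 1) = 1ₚ
ι c       = c ·ₚ 1ₚ

ι≈·ₚ : ∀ c → ι c ≈ c ·ₚ 1ₚ
ι≈·ₚ (ℤ.+ 0)             i j = refl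
ι≈·ₚ (ℤ.+ 1)             i j = sym (ℤP.*-identityˡ (1ₚ i j))
ι≈·ₚ (ℤ.+ suc (suc n))   i j = refl
ι≈·ₚ ℤ.-[1+ n ]          i j = refl

·ₚ-⊗ : ∀ c f g → (c ·ₚ f) ⊗ g ≈ c ·ₚ (f ⊗ g)
·ₚ-⊗ c f g i j = sym (trans (*-distribˡ-sumTo i c _) (sumTo-congʳ i (λ a →
  trans (*-distribˡ-sumTo j c _) (sumTo-congʳ j (λ b → sym (ℤP.*-assoc c (f a b) _))))))

·ₚ≈⊗ : ∀ c f → c ·ₚ f ≈ (c ·ₚ 1ₚ) ⊗ f
·ₚ≈⊗ c f = ≈-sym (≈-trans (·ₚ-⊗ c 1ₚ f) (λ i j → cong (c *ℤ_) (⊗-identityˡ f i j)))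

ι-homomorphism : ℤ.+-*-rawRing ACR.-Raw-AlmostCommutative⟶ ACR.fromCommutativeRing PS-commutativeRing
ι-homomorphism = record
  { ⟦_⟧    = ι
  ; +-homo = λ a b i j → trans (ι≈·ₚ (a +ℤ b) i j)
               (trans (ℤP.*-distribʳ-+ (1ₚ i j) a b) (sym (cong₂ _+ℤ_ (ι≈·ₚ a i j) (ι≈·ₚ b i j))))
  ; *-homo = λ a b → ≈-trans (ι≈·ₚ (a *ℤ b)) (≈-sym (≈-trans (⊗-cong (ι≈·ₚ a) (ι≈·ₚ b))
               (≈-trans (≈-sym (·ₚ≈⊗ a (b ·ₚ 1ₚ))) (λ i j → sym (ℤP.*-assoc a b (1ₚ i j))))))
  ; -‿homo = λ a i j → trans (ι≈·ₚ (- a) i j) (trans (sym (ℤP.neg-distribˡ-* a (1ₚ i j))) (cong -_ (sym (ι≈·ₚ a i j))))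
  ; 0-homo = ≈-refl
  ; 1-homo = ≈-refl
  }

ι-≟ : ∀ a b → Maybe (ι a ≈ ι b)
ι-≟ a b with a ℤP.≟ b
... | yes refl = just ≈-refl
... | no _     = nothing

open import Algebra.Solver.Ring ℤ.+-*-rawRing (ACR.fromCommutativeRing PS-commutativeRing) ι-homomorphism ι-≟
  using (solve; _:=_; _:+_; _:*_; _:-_; :-_; con; Polynomial)

·ₚ-identityˡ : ∀ f → 1ℤ ·ₚ f ≈ f
·ₚ-identityˡ f i j = ℤP.*-identityˡ (f i j)

·ₚ-cong : ∀ c {f g} → f ≈ g → c ·ₚ f ≈ c ·ₚ g
·ₚ-cong c f≈g i j = cong (c *ℤ_) (f≈g i j)

sgn-suc-·ₚ : ∀ n f → sgn (suc n) ·ₚ f ≈ ⊖ (sgn n ·ₚ f)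
sgn-suc-·ₚ n f i j = sym (ℤP.neg-distribˡ-* (sgn n) (f i j))

·ₚ-⊗-comm : ∀ c f g → c ·ₚ (f ⊗ g) ≈ f ⊗ (c ·ₚ g)
·ₚ-⊗-comm c f g = begin
  c ·ₚ (f ⊗ g)          ≈⟨ ·ₚ≈⊗ c (f ⊗ g) ⟩
  (c ·ₚ 1ₚ) ⊗ (f ⊗ g)   ≈⟨ solve 3 (λ s f g → s :* (f :* g) := f :* (s :* g)) ≈-refl (c ·ₚ 1ₚ) f g ⟩
  f ⊗ ((c ·ₚ 1ₚ) ⊗ g)   ≈⟨ ⊗-cong (≈-refl {f}) (≈-sym (·ₚ≈⊗ c g)) ⟩
  f ⊗ (c ·ₚ g)          ∎
  where open ≈-Reasoning

^ₚ-+ : ∀ f m n → f ^ₚ (m ℕ.+ n) ≈ f ^ₚ m ⊗ f ^ₚ n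
^ₚ-+ f zero    n = ≈-sym (⊗-identityˡ (f ^ₚ n))
^ₚ-+ f (suc m) n = ≈-trans (⊗-cong (≈-refl {f}) (^ₚ-+ f m n)) (≈-sym (*-assoc f (f ^ₚ m) (f ^ₚ n)))

αpow-+̄ : ∀ a b → αpow (a +̄ b) ≈ αpow a ⊗ αpow b
αpow-+̄ (fin m) (fin n) = ^ₚ-+ αₚ m n
αpow-+̄ (fin m) ∞       = ≈-sym (zeroʳ (αₚ ^ₚ m))
αpow-+̄ ∞       b       = ≈-sym (zeroˡ (αpow b))

βpow-+̄ : ∀ a b → βpow (a +̄ b) ≈ βpow a ⊗ βpow b
βpow-+̄ (fin m) (fin n) = ^ₚ-+ βₚ m n
βpow-+̄ (fin m) ∞       = ≈-sym (zeroʳ (βₚ ^ₚ m))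
βpow-+̄ ∞       b       = ≈-sym (zeroˡ (βpow b))

αₚ⊗-zero : ∀ f j → (αₚ ⊗ f) 0 j ≡ 0ℤ
αₚ⊗-zero f j = sumTo-zero j _ (λ b → refl)

αₚ⊗-suc : ∀ f i j → (αₚ ⊗ f) (suc i) j ≡ f i j
αₚ⊗-suc f i j = begin
  sumTo (suc i) (λ a → sumTo j (λ b → αₚ a b *ℤ f (suc i ∸ a) (j ∸ b)))
    ≡⟨ sumTo-suc i _ ⟩
  sumTo j (λ b → 0ℤ *ℤ f (suc i) (j ∸ b)) +ℤ sumTo i (λ a → sumTo j (λ b → αₚ (suc a) b *ℤ f (i ∸ a) (j ∸ b)))
    ≡⟨ cong₂ _+ℤ_ (sumTo-zero j _ (λ b → refl)) (sumTo-head i _ (λ a → sumTo-zero j _ (λ b → refl))) ⟩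
  0ℤ +ℤ sumTo j (λ b → αₚ 1 b *ℤ f i (j ∸ b))
    ≡⟨ cong (0ℤ +ℤ_) (sumTo-head j _ (λ b → refl)) ⟩
  0ℤ +ℤ 1ℤ *ℤ f i j
    ≡⟨ trans (ℤP.+-identityˡ _) (ℤP.*-identityˡ _) ⟩
  f i j ∎
  where open ≡-Reasoning

βₚ⊗-zero : ∀ f i → (βₚ ⊗ f) i 0 ≡ 0ℤ
βₚ⊗-zero f i = sumTo-zero i _ λ { zero → refl ; (suc a) → refl }

βₚ⊗-suc : ∀ f i j → (βₚ ⊗ f) i (suc j) ≡ f i j
βₚ⊗-suc f i j = begin
  sumTo i (λ a → sumTo (suc j) (λ b → βₚ a b *ℤ f (i ∸ a) (suc j ∸ b)))
    ≡⟨ sumTo-head i _ (λ a → sumTo-zero (suc j) _ (λ b → refl)) ⟩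
  sumTo (suc j) (λ b → βₚ 0 b *ℤ f i (suc j ∸ b))
    ≡⟨ sumTo-suc j _ ⟩
  0ℤ +ℤ sumTo j (λ b → βₚ 0 (suc b) *ℤ f i (j ∸ b))
    ≡⟨ cong (0ℤ +ℤ_) (sumTo-head j _ (λ b → refl)) ⟩
  0ℤ +ℤ 1ℤ *ℤ f i j
    ≡⟨ trans (ℤP.+-identityˡ _) (ℤP.*-identityˡ _) ⟩
  f i j ∎
  where open ≡-Reasoning

x⊗[1-y]≈x-y⊗x : ∀ x y → x ⊗ (1ₚ ⊖ y) ≈ x ⊖ y ⊗ x
x⊗[1-y]≈x-y⊗x = solve 2 (λ x y → x :* (con 1ℤ :- y) := x :- y :* x) ≈-refl

inv1-α-inverse : inv1-α ⊗ (1ₚ ⊖ αₚ) ≈ 1ₚ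
inv1-α-inverse = ≈-trans (x⊗[1-y]≈x-y⊗x inv1-α αₚ) coefficients
  where
  coefficients : inv1-α ⊖ αₚ ⊗ inv1-α ≈ 1ₚ
  coefficients zero    zero    = cong (λ c → 1ℤ +ℤ - c) (αₚ⊗-zero inv1-α 0)
  coefficients zero    (suc j) = cong (λ c → 0ℤ +ℤ - c) (αₚ⊗-zero inv1-α (suc j))
  coefficients (suc i) zero    = cong (λ c → 1ℤ +ℤ - c) (αₚ⊗-suc inv1-α i 0)
  coefficients (suc i) (suc j) = cong (λ c → 0ℤ +ℤ - c) (αₚ⊗-suc inv1-α i (suc j))

inv1-β-inverse : inv1-β ⊗ (1ₚ ⊖ βₚ) ≈ 1ₚ
inv1-β-inverse = ≈-trans (x⊗[1-y]≈x-y⊗x inv1-β βₚ) coefficients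
  where
  coefficients : inv1-β ⊖ βₚ ⊗ inv1-β ≈ 1ₚ
  coefficients zero    zero    = cong (λ c → 1ℤ +ℤ - c) (βₚ⊗-zero inv1-β 0)
  coefficients (suc i) zero    = cong (λ c → 0ℤ +ℤ - c) (βₚ⊗-zero inv1-β (suc i))
  coefficients zero    (suc j) = cong (λ c → 1ℤ +ℤ - c) (βₚ⊗-suc inv1-β 0 j)
  coefficients (suc i) (suc j) = cong (λ c → 0ℤ +ℤ - c) (βₚ⊗-suc inv1-β (suc i) j)

-- Transfer matrices

-- Whether the block (b₀, b₁) = (τ₂ᵢ, τ₂ᵢ₊₁), preceded by p = τ₂ᵢ₋₁, adds to |τ|₁₀; it adds at
-- most one, as (p, b₀) and (b₀, b₁) cannot both be (1, 0).
descent : Bool → Bool → Bool → Bool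
descent true false _     = true
descent _    true  false = true
descent _    _     _     = false

module BlockWeights {A : Set} (_+_ _*_ : A → A → A) (-_ : A → A) (1# : A) where

  bitTerm : Bool → A → A
  bitTerm false _ = 1#
  bitTerm true  x = - x

  descentWeight : A → Bool → A
  descentWeight w false = w
  descentWeight w true  = w + (- 1#)

  blockWeight : A → Bool → Bool → Bool → A → A → A
  blockWeight w p b₀ b₁ X Y = descentWeight w (descent p b₀ b₁) * (bitTerm b₀ X * bitTerm b₁ Y)

  transferEntry : A → Bool → Bool → A → A → A
  transferEntry w p q X Y = blockWeight w p false q X Y + blockWeight w p true q X Y

open BlockWeights _⊕_ _⊗_ ⊖_ 1ₚ

infix 4 _≈ₘ_ _≈ᵥ_

record _≈ₘ_ (A B : Mat) : Set where
  constructor mk≈ₘ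
  field
    ≈₁₁ : a₁₁ A ≈ a₁₁ B
    ≈₁₂ : a₁₂ A ≈ a₁₂ B
    ≈₂₁ : a₂₁ A ≈ a₂₁ B
    ≈₂₂ : a₂₂ A ≈ a₂₂ B

≈ₘ-trans : ∀ {A B C} → A ≈ₘ B → B ≈ₘ C → A ≈ₘ C
≈ₘ-trans (mk≈ₘ p q r s) (mk≈ₘ p′ q′ r′ s′) =
  mk≈ₘ (≈-trans p p′) (≈-trans q q′) (≈-trans r r′) (≈-trans s s′)

⊠-cong : ∀ {A A′ B B′} → A ≈ₘ A′ → B ≈ₘ B′ → A ⊠ B ≈ₘ A′ ⊠ B′
⊠-cong (mk≈ₘ a b c d) (mk≈ₘ e f g h) =
  mk≈ₘ (⊕-cong (⊗-cong a e) (⊗-cong b g)) (⊕-cong (⊗-cong a f) (⊗-cong b h))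
       (⊕-cong (⊗-cong c e) (⊗-cong d g)) (⊕-cong (⊗-cong c f) (⊗-cong d h))

V₂ : Set
V₂ = PS × PS

_≈ᵥ_ : V₂ → V₂ → Set
_≈ᵥ_ = Pointwise _≈_ _≈_

module ≈ᵥ-Reasoning = SetoidReasoning (×-setoid PS-setoid PS-setoid)

infixr 7 _⊡_
_⊡_ : Mat → V₂ → V₂
mat a b c d ⊡ (x , y) = (a ⊗ x ⊕ b ⊗ y , c ⊗ x ⊕ d ⊗ y)

⊡-cong : ∀ {A B x y} → A ≈ₘ B → x ≈ᵥ y → A ⊡ x ≈ᵥ B ⊡ y
⊡-cong (mk≈ₘ a b c d) (x , y) = ⊕-cong (⊗-cong a x) (⊗-cong b y) , ⊕-cong (⊗-cong c x) (⊗-cong d y)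

⊠-⊡ : ∀ A B x → (A ⊠ B) ⊡ x ≈ᵥ A ⊡ (B ⊡ x)
⊠-⊡ (mat a b c d) (mat e f g h) (x , y) = row a b , row c d
  where
  row : ∀ a b → (a ⊗ e ⊕ b ⊗ g) ⊗ x ⊕ (a ⊗ f ⊕ b ⊗ h) ⊗ y ≈ a ⊗ (e ⊗ x ⊕ f ⊗ y) ⊕ b ⊗ (g ⊗ x ⊕ h ⊗ y)
  row a b = solve 8 (λ a b e f g h x y →
    (a :* e :+ b :* g) :* x :+ (a :* f :+ b :* h) :* y := a :* (e :* x :+ f :* y) :+ b :* (g :* x :+ h :* y))
    ≈-refl a b e f g h x y

-- Symbolic counterparts of the matrices below, so that the entries of a
-- matrix identity can be handed to the ring solver.
record Matₑ (n : ℕ) : Set where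
  constructor matₑ
  field
    m₁₁ m₁₂ m₂₁ m₂₂ : Polynomial n
open Matₑ

infixl 7 _⊠ₑ_
_⊠ₑ_ : ∀ {n} → Matₑ n → Matₑ n → Matₑ n
matₑ a b c d ⊠ₑ matₑ e f g h =
  matₑ (a :* e :+ b :* g) (a :* f :+ b :* h) (c :* e :+ d :* g) (c :* f :+ d :* h)

upper : PS → PS → Mat
upper d X = mat X (d ⊗ (1ₚ ⊖ X)) 0ₚ 1ₚ

lower : PS → PS → Mat
lower c Y = mat 1ₚ 0ₚ (c ⊗ (1ₚ ⊖ Y)) Y

conjugator : PS → Mat
conjugator c = mat 1ₚ 0ₚ c (⊖ c)

transfer : PS → PS → PS → Mat
transfer w X Y = mat (transferEntry w false false X Y) (transferEntry w false true X Y)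
                     (transferEntry w true  false X Y) (transferEntry w true  true X Y)

module Symbolic {n : ℕ} where
  open BlockWeights {Polynomial n} _:+_ _:*_ :-_ (con 1ℤ) using ()
    renaming (transferEntry to transferEntryₑ)

  upperₑ : Polynomial n → Polynomial n → Matₑ n
  upperₑ d X = matₑ X (d :* (con 1ℤ :- X)) (con 0ℤ) (con 1ℤ)

  lowerₑ : Polynomial n → Polynomial n → Matₑ n
  lowerₑ c Y = matₑ (con 1ℤ) (con 0ℤ) (c :* (con 1ℤ :- Y)) Y

  conjugatorₑ : Polynomial n → Matₑ n
  conjugatorₑ c = matₑ (con 1ℤ) (con 0ℤ) c (:- c)

  transferₑ : Polynomial n → Polynomial n → Polynomial n → Matₑ n
  transferₑ w X Y = matₑ (transferEntryₑ w false false X Y) (transferEntryₑ w false true X Y)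
                         (transferEntryₑ w true  false X Y) (transferEntryₑ w true  true X Y)

open Symbolic

upper-⊠ : ∀ d X X′ → upper d X ⊠ upper d X′ ≈ₘ upper d (X ⊗ X′)
upper-⊠ d X X′ = mk≈ₘ
  (solve 3 (λ d X X′ → m₁₁ (upperₑ d X ⊠ₑ upperₑ d X′) := m₁₁ (upperₑ d (X :* X′))) ≈-refl d X X′)
  (solve 3 (λ d X X′ → m₁₂ (upperₑ d X ⊠ₑ upperₑ d X′) := m₁₂ (upperₑ d (X :* X′))) ≈-refl d X X′)
  (solve 3 (λ d X X′ → m₂₁ (upperₑ d X ⊠ₑ upperₑ d X′) := m₂₁ (upperₑ d (X :* X′))) ≈-refl d X X′)
  (solve 3 (λ d X X′ → m₂₂ (upperₑ d X ⊠ₑ upperₑ d X′) := m₂₂ (upperₑ d (X :* X′))) ≈-refl d X X′)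

lower-⊠ : ∀ c Y Y′ → lower c Y ⊠ lower c Y′ ≈ₘ lower c (Y ⊗ Y′)
lower-⊠ c Y Y′ = mk≈ₘ
  (solve 3 (λ c Y Y′ → m₁₁ (lowerₑ c Y ⊠ₑ lowerₑ c Y′) := m₁₁ (lowerₑ c (Y :* Y′))) ≈-refl c Y Y′)
  (solve 3 (λ c Y Y′ → m₁₂ (lowerₑ c Y ⊠ₑ lowerₑ c Y′) := m₁₂ (lowerₑ c (Y :* Y′))) ≈-refl c Y Y′)
  (solve 3 (λ c Y Y′ → m₂₁ (lowerₑ c Y ⊠ₑ lowerₑ c Y′) := m₂₁ (lowerₑ c (Y :* Y′))) ≈-refl c Y Y′)
  (solve 3 (λ c Y Y′ → m₂₂ (lowerₑ c Y ⊠ₑ lowerₑ c Y′) := m₂₂ (lowerₑ c (Y :* Y′))) ≈-refl c Y Y′)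

conjugation : ∀ c d X Y →
  (upper d X ⊠ lower c Y) ⊠ conjugator c ≈ₘ conjugator c ⊠ transfer (c ⊗ d) X Y
conjugation c d X Y = mk≈ₘ
  (solve 4 (λ c d X Y → m₁₁ (lhs c d X Y) := m₁₁ (rhs c d X Y)) ≈-refl c d X Y)
  (solve 4 (λ c d X Y → m₁₂ (lhs c d X Y) := m₁₂ (rhs c d X Y)) ≈-refl c d X Y)
  (solve 4 (λ c d X Y → m₂₁ (lhs c d X Y) := m₂₁ (rhs c d X Y)) ≈-refl c d X Y)
  (solve 4 (λ c d X Y → m₂₂ (lhs c d X Y) := m₂₂ (rhs c d X Y)) ≈-refl c d X Y)
  where
  lhs rhs : Polynomial 4 → Polynomial 4 → Polynomial 4 → Polynomial 4 → Matₑ 4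
  lhs c d X Y = (upperₑ d X ⊠ₑ lowerₑ c Y) ⊠ₑ conjugatorₑ c
  rhs c d X Y = conjugatorₑ c ⊠ₑ transferₑ (c :* d) X Y

⊗-inverse-cancel : ∀ x u a → u ⊗ a ≈ 1ₚ → x ≈ (x ⊗ u) ⊗ a
⊗-inverse-cancel x u a u⊗a≈1 = begin
  x              ≈⟨ ≈-sym (*-identityʳ x) ⟩
  x ⊗ 1ₚ         ≈⟨ ⊗-cong (≈-refl {x}) (≈-sym u⊗a≈1) ⟩
  x ⊗ (u ⊗ a)    ≈⟨ ≈-sym (*-assoc x u a) ⟩
  (x ⊗ u) ⊗ a    ∎
  where open ≈-Reasoning

α/[1-β] β/[1-α] : PS
α/[1-β] = αₚ ⊗ inv1-β
β/[1-α] = βₚ ⊗ inv1-α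

A₁≈upper : A₁ ≈ₘ upper β/[1-α] αₚ
A₁≈upper = mk≈ₘ ≈-refl (⊗-inverse-cancel βₚ inv1-α (1ₚ ⊖ αₚ) inv1-α-inverse) ≈-refl ≈-refl

A₀≈lower : A₀ ≈ₘ lower α/[1-β] βₚ
A₀≈lower = mk≈ₘ ≈-refl ≈-refl (⊗-inverse-cancel αₚ inv1-β (1ₚ ⊖ βₚ) inv1-β-inverse) ≈-refl

0≈x⊗[1-1] : ∀ x → 0ₚ ≈ x ⊗ (1ₚ ⊖ 1ₚ)
0≈x⊗[1-1] = solve 1 (λ x → con 0ℤ := x :* (con 1ℤ :- con 1ℤ)) ≈-refl

x≈x⊗[1-0] : ∀ x → x ≈ x ⊗ (1ₚ ⊖ 0ₚ)
x≈x⊗[1-0] = solve 1 (λ x → x := x :* (con 1ℤ :- con 0ℤ)) ≈-refl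

matPow-upper : ∀ {A} d x → A ≈ₘ upper d x → ∀ k → matPow A k ≈ₘ upper d (x ^ₚ k)
matPow-upper d x A≈ zero    = mk≈ₘ ≈-refl (0≈x⊗[1-1] d) ≈-refl ≈-refl
matPow-upper d x A≈ (suc k) =
  ≈ₘ-trans (⊠-cong A≈ (matPow-upper d x A≈ k)) (upper-⊠ d x (x ^ₚ k))

matPow-lower : ∀ {A} c y → A ≈ₘ lower c y → ∀ k → matPow A k ≈ₘ lower c (y ^ₚ k)
matPow-lower c y A≈ zero    = mk≈ₘ ≈-refl ≈-refl (0≈x⊗[1-1] c) ≈-refl
matPow-lower c y A≈ (suc k) =
  ≈ₘ-trans (⊠-cong A≈ (matPow-lower c y A≈ k)) (lower-⊠ c y (y ^ₚ k))

A₁^≈upper : ∀ k → A₁^ k ≈ₘ upper β/[1-α] (αpow k)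
A₁^≈upper (fin k) = matPow-upper β/[1-α] αₚ A₁≈upper k
A₁^≈upper ∞       = mk≈ₘ ≈-refl (x≈x⊗[1-0] β/[1-α]) ≈-refl ≈-refl

A₀^≈lower : ∀ l → A₀^ l ≈ₘ lower α/[1-β] (βpow l)
A₀^≈lower (fin l) = matPow-lower α/[1-β] βₚ A₀≈lower l
A₀^≈lower ∞       = mk≈ₘ ≈-refl ≈-refl (x≈x⊗[1-0] α/[1-β]) ≈-refl

w : PS
w = α/[1-β] ⊗ β/[1-α]

transferVector : ∀ {N} → Vec (ℕ̄ × ℕ̄) N → V₂
transferVector []            = (1ₚ , 1ₚ)
transferVector ((k , l) ∷ t) = transfer w (αpow k) (βpow l) ⊡ transferVector t

prodMat-conjugate : ∀ {N} (t : Vec (ℕ̄ × ℕ̄) N) →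
  prodMat t ⊡ (1ₚ , 0ₚ) ≈ᵥ conjugator α/[1-β] ⊡ transferVector t
prodMat-conjugate [] =
  solve 0 (con 1ℤ :* con 1ℤ :+ con 0ℤ :* con 0ℤ := con 1ℤ :* con 1ℤ :+ con 0ℤ :* con 1ℤ) ≈-refl ,
  solve 1 (λ c → con 0ℤ :* con 1ℤ :+ con 1ℤ :* con 0ℤ := c :* con 1ℤ :+ :- c :* con 1ℤ) ≈-refl α/[1-β]
prodMat-conjugate ((k , l) ∷ t) = begin
  (A₁^ k ⊠ A₀^ l ⊠ prodMat t) ⊡ e₁     ≈⟨ ⊠-⊡ (A₁^ k ⊠ A₀^ l) (prodMat t) e₁ ⟩
  (A₁^ k ⊠ A₀^ l) ⊡ (prodMat t ⊡ e₁)    ≈⟨ ⊡-cong (⊠-cong (A₁^≈upper k) (A₀^≈lower l)) (prodMat-conjugate t) ⟩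
  (U ⊠ L) ⊡ (P ⊡ s)                     ≈˘⟨ ⊠-⊡ (U ⊠ L) P s ⟩
  (U ⊠ L ⊠ P) ⊡ s                       ≈⟨ ⊡-cong (conjugation α/[1-β] β/[1-α] X Y) (≈-refl {proj₁ s} , ≈-refl {proj₂ s}) ⟩
  (P ⊠ transfer w X Y) ⊡ s              ≈⟨ ⊠-⊡ P (transfer w X Y) s ⟩
  P ⊡ transfer w X Y ⊡ s                ∎
  where
  open ≈ᵥ-Reasoning
  e₁ = (1ₚ , 0ₚ)
  X = αpow k
  Y = βpow l
  U = upper β/[1-α] X
  L = lower α/[1-β] Y
  P = conjugator α/[1-β]
  s = transferVector t

γ≈transferVector : ∀ {N} (t : Vec (ℕ̄ × ℕ̄) N) → γ t ≈ proj₁ (transferVector t)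
γ≈transferVector t = begin
  a₁₁ M                              ≈⟨ solve 2 (λ a b → a := a :* con 1ℤ :+ b :* con 0ℤ) ≈-refl (a₁₁ M) (a₁₂ M) ⟩
  proj₁ (M ⊡ (1ₚ , 0ₚ))              ≈⟨ proj₁ (prodMat-conjugate t) ⟩
  proj₁ (conjugator α/[1-β] ⊡ s)     ≈⟨ solve 2 (λ x y → con 1ℤ :* x :+ con 0ℤ :* y := x) ≈-refl (proj₁ s) (proj₂ s) ⟩
  proj₁ s                            ∎
  where
  open ≈-Reasoning
  M = prodMat t
  s = transferVector t

-- The state sum

≡⇒≈ : ∀ {f g} → f ≡ g → f ≈ g
≡⇒≈ refl = ≈-refl

sumOver : ∀ {A : Set} → List A → (A → PS) → PS
sumOver xs F = Σₚ (map F xs)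

module _ {A : Set} where

  sumOver-cong : ∀ {F G : A → PS} {xs} → ListAll.All (λ x → F x ≈ G x) xs → sumOver xs F ≈ sumOver xs G
  sumOver-cong []           = ≈-refl
  sumOver-cong (Fx≈Gx ∷ eq) = ⊕-cong Fx≈Gx (sumOver-cong eq)

  sumOver-++ : ∀ xs ys (F : A → PS) → sumOver (xs ++ ys) F ≈ sumOver xs F ⊕ sumOver ys F
  sumOver-++ []       ys F = ≈-sym (+-identityˡ (sumOver ys F))
  sumOver-++ (x ∷ xs) ys F = ≈-trans (⊕-cong (≈-refl {F x}) (sumOver-++ xs ys F)) (≈-sym (+-assoc (F x) _ _))

  sumOver-⊕ : ∀ xs (F G : A → PS) → sumOver xs (λ x → F x ⊕ G x) ≈ sumOver xs F ⊕ sumOver xs G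
  sumOver-⊕ []       F G = ≈-sym (+-identityˡ 0ₚ)
  sumOver-⊕ (x ∷ xs) F G = ≈-trans (⊕-cong (≈-refl {F x ⊕ G x}) (sumOver-⊕ xs F G))
    (solve 4 (λ a b c d → (a :+ b) :+ (c :+ d) := (a :+ c) :+ (b :+ d)) ≈-refl (F x) (G x) (sumOver xs F) (sumOver xs G))

  ⊗-sumOver : ∀ c xs (F : A → PS) → c ⊗ sumOver xs F ≈ sumOver xs (λ x → c ⊗ F x)
  ⊗-sumOver c []       F = zeroʳ c
  ⊗-sumOver c (x ∷ xs) F = ≈-trans (distribˡ c (F x) (sumOver xs F)) (⊕-cong (≈-refl {c ⊗ F x}) (⊗-sumOver c xs F))

  sumOver-zero : ∀ xs → sumOver {A} xs (λ _ → 0ₚ) ≈ 0ₚ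
  sumOver-zero []       = ≈-refl
  sumOver-zero (x ∷ xs) = ≈-trans (+-identityˡ _) (sumOver-zero xs)

  sumOver-filter-∷ : ∀ {P : A → Set} (P? : ∀ x → Dec (P x)) x xs (F : A → PS) →
    sumOver (filter P? (x ∷ xs)) F ≈ (if does (P? x) then F x else 0ₚ) ⊕ sumOver (filter P? xs) F
  sumOver-filter-∷ P? x xs F with does (P? x)
  ... | true  = ≈-refl
  ... | false = ≈-sym (+-identityˡ _)

indicator : ℕ → (ℕ → PS) → ℕ → PS
indicator c H n = if does (c ℕP.≟ n) then H n else 0ₚ

sumOver-upTo-suc : ∀ M (F : ℕ → PS) → sumOver (upTo (suc M)) F ≈ sumOver (upTo M) F ⊕ F M
sumOver-upTo-suc M F = ≈-trans (≡⇒≈ (cong (λ xs → sumOver xs F) (sym (ListP.upTo-∷ʳ M))))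
  (≈-trans (sumOver-++ (upTo M) (M ∷ []) F) (⊕-cong (≈-refl {sumOver (upTo M) F}) (+-identityʳ (F M))))

sumOver-indicator-below : ∀ M {c} H → M ≤ c → sumOver (upTo M) (indicator c H) ≈ 0ₚ
sumOver-indicator-below zero    H _ = ≈-refl
sumOver-indicator-below (suc M) {c} H M<c = begin
  sumOver (upTo (suc M)) (indicator c H)        ≈⟨ sumOver-upTo-suc M (indicator c H) ⟩
  sumOver (upTo M) (indicator c H) ⊕ indicator c H M
    ≈⟨ ⊕-cong (sumOver-indicator-below M H (ℕP.<⇒≤ M<c))
              (≡⇒≈ (cong (if_then H M else 0ₚ) (dec-false (c ℕP.≟ M) (ℕP.>⇒≢ M<c)))) ⟩
  0ₚ ⊕ 0ₚ                                       ≈⟨ +-identityˡ 0ₚ ⟩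
  0ₚ                                            ∎
  where open ≈-Reasoning

sumOver-indicator : ∀ M {c} H → c < M → sumOver (upTo M) (indicator c H) ≈ H c
sumOver-indicator (suc M) {c} H c<1+M with c ℕP.≟ M
... | yes refl = begin
  sumOver (upTo (suc M)) (indicator M H)         ≈⟨ sumOver-upTo-suc M (indicator M H) ⟩
  sumOver (upTo M) (indicator M H) ⊕ indicator M H M
    ≈⟨ ⊕-cong (sumOver-indicator-below M H ℕP.≤-refl) (≡⇒≈ (cong (if_then H M else 0ₚ) (dec-true (M ℕP.≟ M) refl))) ⟩
  0ₚ ⊕ H M                                       ≈⟨ +-identityˡ (H M) ⟩
  H M                                            ∎
  where open ≈-Reasoning
... | no c≢M = begin
  sumOver (upTo (suc M)) (indicator c H)         ≈⟨ sumOver-upTo-suc M (indicator c H) ⟩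
  sumOver (upTo M) (indicator c H) ⊕ indicator c H M
    ≈⟨ ⊕-cong (sumOver-indicator M H (ℕP.≤∧≢⇒< (ℕP.≤-pred c<1+M) c≢M))
              (≡⇒≈ (cong (if_then H M else 0ₚ) (dec-false (c ℕP.≟ M) c≢M))) ⟩
  H c ⊕ 0ₚ                                       ≈⟨ +-identityʳ (H c) ⟩
  H c                                            ∎
  where open ≈-Reasoning

sumOver-fibres : ∀ {A : Set} M (key : A → ℕ) (G : ℕ → A → PS) xs → ListAll.All (λ x → key x < M) xs →
  sumOver (upTo M) (λ n → sumOver (filter (λ x → key x ℕP.≟ n) xs) (G n)) ≈ sumOver xs (λ x → G (key x) x)
sumOver-fibres M key G []       []             = sumOver-zero (upTo M)
sumOver-fibres M key G (x ∷ xs) (kx<M ∷ bound) = begin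
  sumOver (upTo M) (λ n → sumOver (filter (λ y → key y ℕP.≟ n) (x ∷ xs)) (G n))
    ≈⟨ sumOver-cong (ListAll.universal (λ n → sumOver-filter-∷ (λ y → key y ℕP.≟ n) x xs (G n)) (upTo M)) ⟩
  sumOver (upTo M) (λ n → indicator (key x) (λ m → G m x) n ⊕ sumOver (filter (λ y → key y ℕP.≟ n) xs) (G n))
    ≈⟨ sumOver-⊕ (upTo M) _ _ ⟩
  sumOver (upTo M) (indicator (key x) (λ m → G m x)) ⊕ sumOver (upTo M) (λ n → sumOver (filter (λ y → key y ℕP.≟ n) xs) (G n))
    ≈⟨ ⊕-cong (sumOver-indicator M (λ m → G m x) kx<M) (sumOver-fibres M key G xs bound) ⟩
  G (key x) x ⊕ sumOver xs (λ y → G (key y) y) ∎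
  where open ≈-Reasoning

sumOver-bits-suc : ∀ m (F : List Bool → PS) →
  sumOver (bits (suc m)) F ≈ sumOver (bits m) (F ∘ (false ∷_)) ⊕ sumOver (bits m) (F ∘ (true ∷_))
sumOver-bits-suc m F = ≈-trans (sumOver-++ (map (false ∷_) (bits m)) (map (true ∷_) (bits m)) F)
  (⊕-cong (≡⇒≈ (cong Σₚ (sym (ListP.map-∘ (bits m))))) (≡⇒≈ (cong Σₚ (sym (ListP.map-∘ (bits m))))))

bits-length : ∀ m → ListAll.All (λ τ → length τ ≡ m) (bits m)
bits-length zero    = refl ∷ []
bits-length (suc m) = ListAllP.++⁺ (ListAllP.map⁺ (ListAll.map (cong suc) (bits-length m)))
                               (ListAllP.map⁺ (ListAll.map (cong suc) (bits-length m)))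

count10-block : ∀ p b₀ b₁ τ →
  count10 (p ∷ b₀ ∷ b₁ ∷ τ) ≡ (if descent p b₀ b₁ then suc (count10 (b₁ ∷ τ)) else count10 (b₁ ∷ τ))
count10-block true  false b₁    τ = refl
count10-block true  true  true  τ = refl
count10-block true  true  false τ = refl
count10-block false true  true  τ = refl
count10-block false true  false τ = refl
count10-block false false b₁    τ = refl

count10-≤ : ∀ τ → count10 τ ≤ ⌊ length τ /2⌋
count10-≤ []                 = z≤n
count10-≤ (false ∷ τ)        = ℕP.≤-trans (count10-≤ τ) (ℕP.⌊n/2⌋-mono (ℕP.n≤1+n _))
count10-≤ (true ∷ [])        = z≤n
count10-≤ (true ∷ false ∷ τ) = s≤s (count10-≤ τ)
count10-≤ (true ∷ true ∷ τ)  = ℕP.≤-trans (count10-≤ (true ∷ τ)) (ℕP.⌊n/2⌋-mono (ℕP.n≤1+n _))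

⌊1+n+n/2⌋≡n : ∀ n → ⌊ suc (n ℕ.+ n) /2⌋ ≡ n
⌊1+n+n/2⌋≡n zero    = refl
⌊1+n+n/2⌋≡n (suc n) = cong suc (trans (cong ⌊_/2⌋ (ℕP.+-suc n n)) (⌊1+n+n/2⌋≡n n))

count10-bound : ∀ N b τ → length τ ≡ 2 ℕ.* N → count10 (b ∷ τ) ≤ N
count10-bound N b τ |τ|≡2N = subst (count10 (b ∷ τ) ≤_) ⌊1+|τ|/2⌋≡N (count10-≤ (b ∷ τ))
  where
  ⌊1+|τ|/2⌋≡N : ⌊ suc (length τ) /2⌋ ≡ N
  ⌊1+|τ|/2⌋≡N = trans (cong (λ m → ⌊ suc m /2⌋) (trans |τ|≡2N (cong (N ℕ.+_) (ℕP.+-identityʳ N))))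
                      (⌊1+n+n/2⌋≡n N)

monomial : List Bool → List ℕ̄ → List ℕ̄ → PS
monomial τ es os = sgn (count1 τ) ·ₚ (αpow (dot τ es) ⊗ βpow (dot τ os))

bitTerm-cong : ∀ b {x y} → x ≈ y → bitTerm b x ≈ bitTerm b y
bitTerm-cong false x≈y = ≈-refl
bitTerm-cong true  x≈y = ⊖-cong x≈y

monomial-∷ : ∀ b e o τ es os →
  monomial (b ∷ τ) (e ∷ es) (o ∷ os) ≈ bitTerm b (αpow e ⊗ βpow o) ⊗ monomial τ es os
monomial-∷ false e o τ es os = ≈-sym (⊗-identityˡ (monomial τ es os))
monomial-∷ true  e o τ es os = begin
  sgn (suc c) ·ₚ (αpow (e +̄ D) ⊗ βpow (o +̄ D′))
    ≈⟨ sgn-suc-·ₚ c (αpow (e +̄ D) ⊗ βpow (o +̄ D′)) ⟩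
  ⊖ (sgn c ·ₚ (αpow (e +̄ D) ⊗ βpow (o +̄ D′)))
    ≈⟨ ⊖-cong (·ₚ-cong (sgn c) (⊗-cong (αpow-+̄ e D) (βpow-+̄ o D′))) ⟩
  ⊖ (sgn c ·ₚ ((αpow e ⊗ αpow D) ⊗ (βpow o ⊗ βpow D′)))
    ≈⟨ ⊖-cong (·ₚ-cong (sgn c) (CommSemigroupProperties.interchange *-commutativeSemigroup
                                  (αpow e) (αpow D) (βpow o) (βpow D′))) ⟩
  ⊖ (sgn c ·ₚ ((αpow e ⊗ βpow o) ⊗ (αpow D ⊗ βpow D′)))
    ≈⟨ ⊖-cong (·ₚ-⊗-comm (sgn c) (αpow e ⊗ βpow o) (αpow D ⊗ βpow D′)) ⟩
  ⊖ ((αpow e ⊗ βpow o) ⊗ monomial τ es os)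
    ≈⟨ -‿distribˡ-* (αpow e ⊗ βpow o) (monomial τ es os) ⟩
  ⊖ (αpow e ⊗ βpow o) ⊗ monomial τ es os ∎
  where
  open ≈-Reasoning
  c  = count1 τ
  D  = dot τ es
  D′ = dot τ os

monomial-block : ∀ b₀ b₁ k l τ es os →
  monomial (b₀ ∷ b₁ ∷ τ) (k ∷ fin 0 ∷ es) (fin 0 ∷ l ∷ os) ≈
    bitTerm b₀ (αpow k) ⊗ (bitTerm b₁ (βpow l) ⊗ monomial τ es os)
monomial-block b₀ b₁ k l τ es os =
  ≈-trans (monomial-∷ b₀ k (fin 0) (b₁ ∷ τ) (fin 0 ∷ es) (l ∷ os))
    (⊗-cong (bitTerm-cong b₀ (*-identityʳ (αpow k)))
            (≈-trans (monomial-∷ b₁ (fin 0) l τ es os)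
                     (⊗-cong (bitTerm-cong b₁ (⊗-identityˡ (βpow l))) (≈-refl {monomial τ es os}))))

𝔤-suc : ∀ N n → n ≤ N → 𝔤 (suc N) n ≈ w ⊗ 𝔤 N n
𝔤-suc N n n≤N rewrite ℕP.+-∸-assoc 1 n≤N =
  solve 7 (λ a b u v P Q R → ((a :* b) :* P) :* Q :* ((u :* v) :* R) := ((a :* v) :* (b :* u)) :* (P :* Q :* R))
    ≈-refl αₚ βₚ inv1-α inv1-β ((αₚ ⊗ βₚ) ^ₚ (N ∸ n)) ((1ₚ ⊖ αₚ ⊖ βₚ) ^ₚ n) ((inv1-α ⊗ inv1-β) ^ₚ N)

𝔤-suc-suc : ∀ N n → 𝔤 (suc N) (suc n) ≈ ((1ₚ ⊖ αₚ ⊖ βₚ) ⊗ (inv1-α ⊗ inv1-β)) ⊗ 𝔤 N n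
𝔤-suc-suc N n =
  solve 5 (λ L W P Q R → P :* (L :* Q) :* (W :* R) := (L :* W) :* (P :* Q :* R))
    ≈-refl (1ₚ ⊖ αₚ ⊖ βₚ) (inv1-α ⊗ inv1-β) ((αₚ ⊗ βₚ) ^ₚ (N ∸ n)) ((1ₚ ⊖ αₚ ⊖ βₚ) ^ₚ n) ((inv1-α ⊗ inv1-β) ^ₚ N)

descent-weight : ⊖ ((1ₚ ⊖ αₚ ⊖ βₚ) ⊗ (inv1-α ⊗ inv1-β)) ≈ w ⊖ 1ₚ
descent-weight = begin
  ⊖ ((1ₚ ⊖ αₚ ⊖ βₚ) ⊗ (inv1-α ⊗ inv1-β))
    ≈⟨ solve 4 (λ a b u v → :- ((con 1ℤ :- a :- b) :* (u :* v))
                            := (a :* v) :* (b :* u) :- (u :* (con 1ℤ :- a)) :* (v :* (con 1ℤ :- b)))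
               ≈-refl αₚ βₚ inv1-α inv1-β ⟩
  w ⊖ (inv1-α ⊗ (1ₚ ⊖ αₚ)) ⊗ (inv1-β ⊗ (1ₚ ⊖ βₚ))
    ≈⟨ ⊕-cong (≈-refl {w}) (⊖-cong (≈-trans (⊗-cong inv1-α-inverse inv1-β-inverse) (⊗-identityˡ 1ₚ))) ⟩
  w ⊖ 1ₚ ∎
  where open ≈-Reasoning

signed𝔤 : ℕ → ℕ → PS
signed𝔤 N n = sgn n ·ₚ 𝔤 N n

signed𝔤-step : ∀ N d c → c ≤ N →
  signed𝔤 (suc N) (if d then suc c else c) ≈ descentWeight w d ⊗ signed𝔤 N c
signed𝔤-step N false c c≤N =
  ≈-trans (·ₚ-cong (sgn c) (𝔤-suc N c c≤N)) (·ₚ-⊗-comm (sgn c) w (𝔤 N c))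
signed𝔤-step N true  c _   = begin
  sgn (suc c) ·ₚ 𝔤 (suc N) (suc c)          ≈⟨ sgn-suc-·ₚ c (𝔤 (suc N) (suc c)) ⟩
  ⊖ (sgn c ·ₚ 𝔤 (suc N) (suc c))            ≈⟨ ⊖-cong (·ₚ-cong (sgn c) (𝔤-suc-suc N c)) ⟩
  ⊖ (sgn c ·ₚ (LW ⊗ 𝔤 N c))                 ≈⟨ ⊖-cong (·ₚ-⊗-comm (sgn c) LW (𝔤 N c)) ⟩
  ⊖ (LW ⊗ signed𝔤 N c)                      ≈⟨ -‿distribˡ-* LW (signed𝔤 N c) ⟩
  ⊖ LW ⊗ signed𝔤 N c                        ≈⟨ ⊗-cong descent-weight (≈-refl {signed𝔤 N c}) ⟩
  (w ⊖ 1ₚ) ⊗ signed𝔤 N c                    ∎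
  where
  open ≈-Reasoning
  LW = (1ₚ ⊖ αₚ ⊖ βₚ) ⊗ (inv1-α ⊗ inv1-β)

-- The bit p in front of τ records the last bit of the previous block.
summand : ∀ {N} → Bool → Vec (ℕ̄ × ℕ̄) N → List Bool → PS
summand {N} p t τ = signed𝔤 N (count10 (p ∷ τ)) ⊗ monomial τ (tₑ t) (tₒ t)

stateSum : ∀ {N} → Bool → Vec (ℕ̄ × ℕ̄) N → PS
stateSum {N} p t = sumOver (bits (2 ℕ.* N)) (summand p t)

summand-block : ∀ {N} p b₀ b₁ k l (t : Vec (ℕ̄ × ℕ̄) N) τ → count10 (b₁ ∷ τ) ≤ N →
  summand p ((k , l) ∷ t) (b₀ ∷ b₁ ∷ τ) ≈ blockWeight w p b₀ b₁ (αpow k) (βpow l) ⊗ summand b₁ t τ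
summand-block {N} p b₀ b₁ k l t τ c≤N rewrite count10-block p b₀ b₁ τ =
  ≈-trans (⊗-cong (signed𝔤-step N (descent p b₀ b₁) c c≤N) (monomial-block b₀ b₁ k l τ (tₑ t) (tₒ t)))
          (solve 5 (λ d g x y m → (d :* g) :* (x :* (y :* m)) := (d :* (x :* y)) :* (g :* m))
             ≈-refl (descentWeight w (descent p b₀ b₁)) (signed𝔤 N c) (bitTerm b₀ (αpow k)) (bitTerm b₁ (βpow l))
             (monomial τ (tₑ t) (tₒ t)))
  where c = count10 (b₁ ∷ τ)

stateSum-∷ : ∀ {N} p k l (t : Vec (ℕ̄ × ℕ̄) N) →
  stateSum p ((k , l) ∷ t) ≈
    transferEntry w p false (αpow k) (βpow l) ⊗ stateSum false t ⊕ transferEntry w p true (αpow k) (βpow l) ⊗ stateSum true t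
stateSum-∷ {N} p k l t = begin
  sumOver (bits (2 ℕ.* suc N)) F
    ≡⟨ cong (λ m → sumOver (bits m) F) (ℕP.*-suc 2 N) ⟩
  sumOver (bits (suc (suc m))) F
    ≈⟨ ≈-trans (sumOver-bits-suc (suc m) F) (⊕-cong (sumOver-bits-suc m _) (sumOver-bits-suc m _)) ⟩
  (Σblock false false ⊕ Σblock false true) ⊕ (Σblock true false ⊕ Σblock true true)
    ≈⟨ ⊕-cong (⊕-cong (block false false) (block false true)) (⊕-cong (block true false) (block true true)) ⟩
  (B false false ⊗ S₀ ⊕ B false true ⊗ S₁) ⊕ (B true false ⊗ S₀ ⊕ B true true ⊗ S₁)
    ≈⟨ solve 6 (λ a b c d x y → (a :* x :+ b :* y) :+ (c :* x :+ d :* y) := (a :+ c) :* x :+ (b :+ d) :* y)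
         ≈-refl (B false false) (B false true) (B true false) (B true true) S₀ S₁ ⟩
  (B false false ⊕ B true false) ⊗ S₀ ⊕ (B false true ⊕ B true true) ⊗ S₁ ∎
  where
  open ≈-Reasoning
  m = 2 ℕ.* N
  F = summand p ((k , l) ∷ t)
  S₀ = stateSum false t
  S₁ = stateSum true t
  B : Bool → Bool → PS
  B b₀ b₁ = blockWeight w p b₀ b₁ (αpow k) (βpow l)
  Σblock : Bool → Bool → PS
  Σblock b₀ b₁ = sumOver (bits m) (λ τ → F (b₀ ∷ b₁ ∷ τ))
  block : ∀ b₀ b₁ → Σblock b₀ b₁ ≈ B b₀ b₁ ⊗ stateSum b₁ t
  block b₀ b₁ = ≈-trans
    (sumOver-cong (ListAll.map (λ {τ} |τ|≡m → summand-block p b₀ b₁ k l t τ (count10-bound N b₁ τ |τ|≡m)) (bits-length m)))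
    (≈-sym (⊗-sumOver (B b₀ b₁) (bits m) (summand b₁ t)))

count10-singleton : ∀ p → count10 (p ∷ []) ≡ 0
count10-singleton false = refl
count10-singleton true  = refl

stateSum-[] : ∀ p → stateSum p [] ≈ 1ₚ
stateSum-[] p rewrite count10-singleton p =
  ≈-trans (⊕-cong (⊗-cong (·ₚ-identityˡ (𝔤 0 0)) (·ₚ-identityˡ (1ₚ ⊗ 1ₚ))) (≈-refl {0ₚ}))
          (solve 0 ((con 1ℤ :* con 1ℤ) :* con 1ℤ :* (con 1ℤ :* con 1ℤ) :+ con 0ℤ := con 1ℤ) ≈-refl)

component : Bool → V₂ → PS
component false = proj₁
component true  = proj₂

stateSum≈transferVector : ∀ {N} p (t : Vec (ℕ̄ × ℕ̄) N) → stateSum p t ≈ component p (transferVector t)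
stateSum≈transferVector false []            = stateSum-[] false
stateSum≈transferVector true  []            = stateSum-[] true
stateSum≈transferVector p     ((k , l) ∷ t) =
  ≈-trans (stateSum-∷ p k l t)
    (≈-trans (⊕-cong (⊗-cong (≈-refl {T p false}) (stateSum≈transferVector false t))
                     (⊗-cong (≈-refl {T p true}) (stateSum≈transferVector true t)))
             (≡⇒≈ (component-transfer p)))
  where
  s = transferVector t
  T : Bool → Bool → PS
  T p q = transferEntry w p q (αpow k) (βpow l)
  component-transfer : ∀ p → T p false ⊗ proj₁ s ⊕ T p true ⊗ proj₂ s ≡ component p (transfer w (αpow k) (βpow l) ⊡ s)
  component-transfer false = refl
  component-transfer true  = refl

RHS≈stateSum : ∀ {N} (t : Vec (ℕ̄ × ℕ̄) N) → RHS t ≈ stateSum false t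
RHS≈stateSum {N} t = begin
  sumOver (upTo (suc N)) (λ n → sgn n ·ₚ (𝔤 N n ⊗ ℭ t n))
    ≈⟨ sumOver-cong (ListAll.universal fibre (upTo (suc N))) ⟩
  sumOver (upTo (suc N)) (λ n → sumOver (filter (λ τ → count10 τ ℕP.≟ n) (bits m)) (G n))
    ≈⟨ sumOver-fibres (suc N) count10 G (bits m) (ListAll.map (λ {τ} → count10<1+N {τ}) (bits-length m)) ⟩
  stateSum false t ∎
  where
  open ≈-Reasoning
  m = 2 ℕ.* N
  G : ℕ → List Bool → PS
  G n τ = signed𝔤 N n ⊗ monomial τ (tₑ t) (tₒ t)
  fibre : ∀ n → sgn n ·ₚ (𝔤 N n ⊗ ℭ t n) ≈ sumOver (filter (λ τ → count10 τ ℕP.≟ n) (bits m)) (G n)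
  fibre n = ≈-trans (≈-sym (·ₚ-⊗ (sgn n) (𝔤 N n) (ℭ t n)))
                    (⊗-sumOver (signed𝔤 N n) (filter (λ τ → count10 τ ℕP.≟ n) (bits m)) (λ τ → monomial τ (tₑ t) (tₒ t)))
  count10<1+N : ∀ {τ} → length τ ≡ m → count10 τ < suc N
  count10<1+N {τ} |τ|≡m = s≤s (count10-bound N false τ |τ|≡m)

theorem3p1 : (N : ℕ) → 1 ≤ N → (t : Vec (ℕ̄ × ℕ̄) N) →
    All (λ p → Pos (proj₁ p) × Pos (proj₂ p)) t →
    γ t ≈ RHS t
theorem3p1 N _ t _ = begin
  γ t                         ≈⟨ γ≈transferVector t ⟩
  proj₁ (transferVector t)    ≈˘⟨ stateSum≈transferVector false t ⟩
  stateSum false t            ≈˘⟨ RHS≈stateSum t ⟩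
  RHS t                       ∎
  where open ≈-Reasoning
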